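{- Let $G$ be a finite group and $x$ an involution of $G$. Then $\langle x\rangle$ is a perfect code of $G$ if and only if $x$ is not a square in $G$ (i.e., there is no $y\in G$ with $y^2=x$).
   Context: For an inverse-closed subset $S\subseteq G$ with $e\notin S$, the Cayley graph $\mathrm{Cay}(G,S)$ has vertex set $G$, with distinct $u,v$ adjacent iff $vu^{ -1}\in S$. A subset $C$ of the vertex set of a graph is a perfect code if it is independent and every vertex outside $C$ is adjacent to exactly one vertex of $C$. A subset $C$ of $G$ is a perfect code of $G$ if some Cayley graph $\mathrm{Cay}(G,S)$ admits $C$ as a perfect code. -}

module Defs where

open import Level using (0ℓ)
open import Data.Nat using (ℕ; zero; suc)
open import Data.Fin using (Fin)
open import Data.Product using (Σ; ∃; ∃-syntax; _×_; ∃!)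
open import Relation.Unary using (Pred)
open import Relation.Nullary using (¬_)
open import Relation.Binary.PropositionalEquality using (_≡_; _≢_)
open import Algebra.Structures using (IsGroup)

-- A finite group of order n, presented on the carrier Fin n with
-- propositional equality (every finite group is isomorphic to one such).
record FinGroup (n : ℕ) : Set where
  field
    _∙_     : Fin n → Fin n → Fin n
    e       : Fin n
    _⁻¹     : Fin n → Fin n
    isGroup : IsGroup _≡_ _∙_ e _⁻¹
  infixl 7 _∙_
  infix 8 _⁻¹

  _^_ : Fin n → ℕ → Fin n
  g ^ zero  = e
  g ^ suc k = g ∙ (g ^ k)

  Involution : Fin n → Set
  Involution x = x ≢ e × x ∙ x ≡ e

  IsSquare : Fin n → Set
  IsSquare x = ∃[ y ] y ∙ y ≡ x

  -- the cyclic subgroup ⟨x⟩ generated by x (G finite, so ℕ-powers suffice)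
  ⟨_⟩ : Fin n → Pred (Fin n) 0ℓ
  ⟨ x ⟩ g = ∃[ k ] g ≡ x ^ k

  IsConnectionSet : Pred (Fin n) 0ℓ → Set
  IsConnectionSet S = (∀ s → S s → S (s ⁻¹)) × ¬ S e

  Adj : Pred (Fin n) 0ℓ → Fin n → Fin n → Set
  Adj S u v = u ≢ v × S (v ∙ u ⁻¹)

  IsPerfectCodeIn : Pred (Fin n) 0ℓ → Pred (Fin n) 0ℓ → Set
  IsPerfectCodeIn S C =
    (∀ u v → C u → C v → ¬ Adj S u v) ×
    (∀ v → ¬ C v → ∃! _≡_ (λ c → C c × Adj S c v))

  IsPerfectCode : Pred (Fin n) 0ℓ → Set₁
  IsPerfectCode C = Σ (Pred (Fin n) 0ℓ) (λ S → IsConnectionSet S × IsPerfectCodeIn S C)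

-- Since ⟨x⟩ = {e, x}, the set ⟨x⟩ is a perfect code of Cay(G,S) exactly when S avoids
-- ⟨x⟩ and contains precisely one of v, v x for each v ∉ ⟨x⟩. If y² = x, then y x = y⁻¹,
-- so an inverse-closed S contains both of y, y x or neither. Conversely, inversion and
-- conjugation by x generate a Klein four-group acting on G, and v ↦ v x moves each of its
-- orbits to another orbit, a different one unless x is a square. Choosing, for each v,
-- whichever of v, v x has the orbit with the smaller least element gives an S that is a
-- union of orbits, hence inverse-closed.
module Submission where

open import Defs
open import Data.Nat using (ℕ; zero; suc; _<_; _≤_)
open import Data.Fin using (Fin; toℕ)
open import Data.Product using (_×_; _,_; proj₁; proj₂; ∃!)
open import Relation.Nullary using (¬_)

open import Level using (0ℓ)
open import Data.Nat.Properties using (≤-antisym; <-cmp; <-asym)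
open import Data.Fin.Properties using (toℕ-injective)
open import Data.List using (List; []; _∷_)
open import Data.List.Membership.Propositional using (_∈_)
open import Data.List.Relation.Unary.Any using (here; there)
open import Data.List.Relation.Unary.All using (lookup)
open import Data.List.Relation.Binary.Subset.Propositional using (_⊆_)
open import Data.List.Extrema.Nat using (argmin; argmin-sel; f[argmin]≤f[xs])
open import Data.Sum using (_⊎_; inj₁; inj₂; [_,_]′)
open import Function using (id)
open import Data.Empty using (⊥-elim)
open import Relation.Unary using (Pred)
open import Relation.Binary.Definitions using (tri<; tri≈; tri>)
open import Relation.Binary.PropositionalEquality
open import Algebra.Bundles using (Group)
open import Algebra.Structures using (module IsGroup)
import Algebra.Properties.Group as GroupProperties
import Algebra.Properties.Quasigroup as QuasigroupProperties
import Algebra.Properties.Monoid as MonoidProperties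

argmin-∈ : ∀ {A : Set} (f : A → ℕ) {a} xs → a ∈ xs → argmin f a xs ∈ xs
argmin-∈ f xs a∈ = [ (λ eq → subst (_∈ xs) (sym eq) a∈) , id ]′ (argmin-sel f _ xs)

argmin-minimal : ∀ {A : Set} (f : A → ℕ) a xs {b} → b ∈ xs → f (argmin f a xs) ≤ f b
argmin-minimal f a xs = lookup (f[argmin]≤f[xs] a xs)

module _ {n : ℕ} (G : FinGroup n) where
  open FinGroup G
  open IsGroup isGroup using (assoc; identityˡ; identityʳ; inverseˡ; inverseʳ)

  group : Group 0ℓ 0ℓ
  group = record
    { Carrier = Fin n ; _≈_ = _≡_ ; _∙_ = _∙_ ; ε = e ; _⁻¹ = _⁻¹ ; isGroup = isGroup }

  open GroupProperties group
    using (⁻¹-involutive; ⁻¹-anti-homo-∙; ε⁻¹≈ε; inverseˡ-unique; inverseʳ-unique; quasigroup)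
  open QuasigroupProperties quasigroup using (cancelˡ; cancelʳ)
  open MonoidProperties (Group.monoid group)
    using () renaming (cancelˡ to inverse-cancelˡ; cancelʳ to inverse-cancelʳ)

  ∙e⁻¹ : ∀ v → v ∙ e ⁻¹ ≡ v
  ∙e⁻¹ v = trans (cong (v ∙_) ε⁻¹≈ε) (identityʳ v)

  module _ (x : Fin n) (x-involution : Involution x) where

    x≢e : x ≢ e
    x≢e = proj₁ x-involution

    x∙x≡e : x ∙ x ≡ e
    x∙x≡e = proj₂ x-involution

    x⁻¹≡x : x ⁻¹ ≡ x
    x⁻¹≡x = sym (inverseˡ-unique x x x∙x≡e)

    x^k≡e⊎x : ∀ k → x ^ k ≡ e ⊎ x ^ k ≡ x
    x^k≡e⊎x zero = inj₁ refl
    x^k≡e⊎x (suc k) with x^k≡e⊎x k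
    ... | inj₁ x^k≡e = inj₂ (trans (cong (x ∙_) x^k≡e) (identityʳ x))
    ... | inj₂ x^k≡x = inj₁ (trans (cong (x ∙_) x^k≡x) x∙x≡e)

    ⟨x⟩⇒≡e⊎≡x : ∀ {g} → ⟨ x ⟩ g → g ≡ e ⊎ g ≡ x
    ⟨x⟩⇒≡e⊎≡x (k , g≡x^k) with x^k≡e⊎x k
    ... | inj₁ x^k≡e = inj₁ (trans g≡x^k x^k≡e)
    ... | inj₂ x^k≡x = inj₂ (trans g≡x^k x^k≡x)

    e∈⟨x⟩ : ⟨ x ⟩ e
    e∈⟨x⟩ = 0 , refl

    x∈⟨x⟩ : ⟨ x ⟩ x
    x∈⟨x⟩ = 1 , sym (identityʳ x)

    ⟨x⟩-∙⁻¹ : ∀ {u v} → ⟨ x ⟩ u → ⟨ x ⟩ v → ⟨ x ⟩ (v ∙ u ⁻¹)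
    ⟨x⟩-∙⁻¹ {u} {v} u∈ v∈ with ⟨x⟩⇒≡e⊎≡x u∈ | ⟨x⟩⇒≡e⊎≡x v∈
    ... | inj₁ refl | _         = subst ⟨ x ⟩ (sym (∙e⁻¹ v)) v∈
    ... | inj₂ refl | inj₁ refl = 1 , trans (identityˡ _) (trans x⁻¹≡x (sym (identityʳ x)))
    ... | inj₂ refl | inj₂ refl = 0 , inverseʳ x

    ⟨x⟩-⁻¹ : ∀ {u} → ⟨ x ⟩ u → ⟨ x ⟩ (u ⁻¹)
    ⟨x⟩-⁻¹ u∈ = subst ⟨ x ⟩ (identityˡ _) (⟨x⟩-∙⁻¹ u∈ e∈⟨x⟩)

    ∉⟨x⟩-⁻¹ : ∀ {v} → ¬ ⟨ x ⟩ v → ¬ ⟨ x ⟩ (v ⁻¹)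
    ∉⟨x⟩-⁻¹ {v} v∉ v⁻¹∈ = v∉ (subst ⟨ x ⟩ (⁻¹-involutive v) (⟨x⟩-⁻¹ v⁻¹∈))

    ∉⟨x⟩-∙x : ∀ {v} → ¬ ⟨ x ⟩ v → ¬ ⟨ x ⟩ (v ∙ x)
    ∉⟨x⟩-∙x {v} v∉ v∙x∈ = v∉ (subst ⟨ x ⟩ (inverse-cancelʳ (inverseʳ x) v) (⟨x⟩-∙⁻¹ x∈⟨x⟩ v∙x∈))

    neighbour-e : ∀ {S v} → ¬ ⟨ x ⟩ v → S v → Adj S e v
    neighbour-e {S} {v} v∉ s =
      (λ e≡v → v∉ (subst ⟨ x ⟩ e≡v e∈⟨x⟩)) , subst S (sym (∙e⁻¹ v)) s

    neighbour-x : ∀ {S v} → ¬ ⟨ x ⟩ v → S (v ∙ x) → Adj S x v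
    neighbour-x {S} {v} v∉ s =
      (λ x≡v → v∉ (subst ⟨ x ⟩ x≡v x∈⟨x⟩)) , subst S (cong (v ∙_) (sym x⁻¹≡x)) s

    ⟨x⟩-neighbour : ∀ {S c v} → ⟨ x ⟩ c → Adj S c v → (c ≡ e × S v) ⊎ (c ≡ x × S (v ∙ x))
    ⟨x⟩-neighbour {S} {v = v} c∈ (_ , s) with ⟨x⟩⇒≡e⊎≡x c∈
    ... | inj₁ refl = inj₁ (refl , subst S (∙e⁻¹ v) s)
    ... | inj₂ refl = inj₂ (refl , subst S (cong (v ∙_) x⁻¹≡x) s)

    √x∉⟨x⟩ : ∀ {y} → y ∙ y ≡ x → ¬ ⟨ x ⟩ y
    √x∉⟨x⟩ y∙y≡x y∈ with ⟨x⟩⇒≡e⊎≡x y∈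
    ... | inj₁ refl = x≢e (trans (sym y∙y≡x) (identityˡ e))
    ... | inj₂ refl = x≢e (trans (sym y∙y≡x) x∙x≡e)

    √x-∙x : ∀ {y} → y ∙ y ≡ x → y ∙ x ≡ y ⁻¹
    √x-∙x {y} y∙y≡x = inverseʳ-unique y (y ∙ x)
      (trans (sym (assoc y y x)) (trans (cong (_∙ x) y∙y≡x) x∙x≡e))

    perfectCode⇒¬square : IsPerfectCode ⟨ x ⟩ → ¬ IsSquare x
    perfectCode⇒¬square (S , (S-⁻¹ , _) , _ , uniqueNeighbour) (y , y∙y≡x)
      with uniqueNeighbour y (√x∉⟨x⟩ y∙y≡x)
    ... | c , (c∈ , c-adj) , unique = x≢e (trans (sym c≡x) c≡e)
      where
      y∉ : ¬ ⟨ x ⟩ y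
      y∉ = √x∉⟨x⟩ y∙y≡x

      S[y] : S y
      S[y] with ⟨x⟩-neighbour {S} c∈ c-adj
      ... | inj₁ (_ , s) = s
      ... | inj₂ (_ , s) = subst S (⁻¹-involutive y) (S-⁻¹ _ (subst S (√x-∙x y∙y≡x) s))

      c≡e : c ≡ e
      c≡e = unique (e∈⟨x⟩ , neighbour-e {S} y∉ S[y])

      c≡x : c ≡ x
      c≡x = unique (x∈⟨x⟩ , neighbour-x {S} y∉ (subst S (sym (√x-∙x y∙y≡x)) (S-⁻¹ y S[y])))

    perfectCodeIn-⟨x⟩ : ∀ S → (∀ h → ⟨ x ⟩ h → ¬ S h) →
      (∀ v → ¬ ⟨ x ⟩ v → (S v × ¬ S (v ∙ x)) ⊎ (S (v ∙ x) × ¬ S v)) →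
      IsPerfectCodeIn S ⟨ x ⟩
    perfectCodeIn-⟨x⟩ S S-avoids-⟨x⟩ choice = independent , uniqueNeighbour
      where
      independent : ∀ u v → ⟨ x ⟩ u → ⟨ x ⟩ v → ¬ Adj S u v
      independent u v u∈ v∈ (_ , s) = S-avoids-⟨x⟩ (v ∙ u ⁻¹) (⟨x⟩-∙⁻¹ u∈ v∈) s

      uniqueNeighbour : ∀ v → ¬ ⟨ x ⟩ v → ∃! _≡_ (λ c → ⟨ x ⟩ c × Adj S c v)
      uniqueNeighbour v v∉ with choice v v∉
      ... | inj₁ (s , ¬s′) = e , (e∈⟨x⟩ , neighbour-e {S} v∉ s) , only-e
        where
        only-e : ∀ {c} → ⟨ x ⟩ c × Adj S c v → e ≡ c
        only-e (c∈ , adj) with ⟨x⟩-neighbour {S} c∈ adj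
        ... | inj₁ (c≡e , _) = sym c≡e
        ... | inj₂ (_ , s′) = ⊥-elim (¬s′ s′)
      ... | inj₂ (s′ , ¬s) = x , (x∈⟨x⟩ , neighbour-x {S} v∉ s′) , only-x
        where
        only-x : ∀ {c} → ⟨ x ⟩ c × Adj S c v → x ≡ c
        only-x (c∈ , adj) with ⟨x⟩-neighbour {S} c∈ adj
        ... | inj₁ (_ , s) = ⊥-elim (¬s s)
        ... | inj₂ (c≡x , _) = sym c≡x

    conj : Fin n → Fin n
    conj a = x ∙ a ∙ x

    conj-involutive : ∀ a → conj (conj a) ≡ a
    conj-involutive a = begin
      x ∙ (x ∙ a ∙ x) ∙ x   ≡⟨ cong (_∙ x) (assoc x (x ∙ a) x) ⟨
      x ∙ (x ∙ a) ∙ x ∙ x   ≡⟨ inverse-cancelʳ x∙x≡e (x ∙ (x ∙ a)) ⟩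
      x ∙ (x ∙ a)           ≡⟨ inverse-cancelˡ x∙x≡e a ⟩
      a                     ∎
      where open ≡-Reasoning

    conj-⁻¹ : ∀ a → conj a ⁻¹ ≡ conj (a ⁻¹)
    conj-⁻¹ a = begin
      (x ∙ a ∙ x) ⁻¹          ≡⟨ ⁻¹-anti-homo-∙ (x ∙ a) x ⟩
      x ⁻¹ ∙ (x ∙ a) ⁻¹       ≡⟨ cong (x ⁻¹ ∙_) (⁻¹-anti-homo-∙ x a) ⟩
      x ⁻¹ ∙ (a ⁻¹ ∙ x ⁻¹)    ≡⟨ cong₂ (λ l r → l ∙ (a ⁻¹ ∙ r)) x⁻¹≡x x⁻¹≡x ⟩
      x ∙ (a ⁻¹ ∙ x)          ≡⟨ assoc x (a ⁻¹) x ⟨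
      x ∙ a ⁻¹ ∙ x            ∎
      where open ≡-Reasoning

    orbit : Fin n → List (Fin n)
    orbit v = v ∷ v ⁻¹ ∷ conj v ∷ conj (v ⁻¹) ∷ []

    orbit-⁻¹ : ∀ {a v} → a ∈ orbit v → a ⁻¹ ∈ orbit v
    orbit-⁻¹ (here refl) = there (here refl)
    orbit-⁻¹ (there (here refl)) = here (⁻¹-involutive _)
    orbit-⁻¹ (there (there (here refl))) = there (there (there (here (conj-⁻¹ _))))
    orbit-⁻¹ (there (there (there (here refl)))) =
      there (there (here (trans (conj-⁻¹ _) (cong conj (⁻¹-involutive _)))))

    orbit-conj : ∀ {a v} → a ∈ orbit v → conj a ∈ orbit v
    orbit-conj (here refl) = there (there (here refl))
    orbit-conj (there (here refl)) = there (there (there (here refl)))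
    orbit-conj (there (there (here refl))) = here (conj-involutive _)
    orbit-conj (there (there (there (here refl)))) = there (here (conj-involutive _))

    orbit-⊆ : ∀ {a v} → a ∈ orbit v → orbit a ⊆ orbit v
    orbit-⊆ a∈ (here refl) = a∈
    orbit-⊆ a∈ (there (here refl)) = orbit-⁻¹ a∈
    orbit-⊆ a∈ (there (there (here refl))) = orbit-conj a∈
    orbit-⊆ a∈ (there (there (there (here refl)))) = orbit-conj (orbit-⁻¹ a∈)

    orbit-sym : ∀ {a v} → a ∈ orbit v → v ∈ orbit a
    orbit-sym (here refl) = here refl
    orbit-sym (there (here refl)) = there (here (sym (⁻¹-involutive _)))
    orbit-sym (there (there (here refl))) = there (there (here (sym (conj-involutive _))))
    orbit-sym {v = v} (there (there (there (here refl)))) = there (there (there (here (sym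
      (trans (cong conj (conj-⁻¹ (v ⁻¹))) (trans (conj-involutive _) (⁻¹-involutive v)))))))

    ⁻¹∙x∈orbit[∙x] : ∀ v → v ⁻¹ ∙ x ∈ orbit (v ∙ x)
    ⁻¹∙x∈orbit[∙x] v = there (there (there (here (cong (_∙ x) (begin
      v ⁻¹                 ≡⟨ inverse-cancelˡ x∙x≡e (v ⁻¹) ⟨
      x ∙ (x ∙ v ⁻¹)       ≡⟨ cong (λ r → x ∙ (r ∙ v ⁻¹)) x⁻¹≡x ⟨
      x ∙ (x ⁻¹ ∙ v ⁻¹)    ≡⟨ cong (x ∙_) (⁻¹-anti-homo-∙ v x) ⟨
      x ∙ (v ∙ x) ⁻¹       ∎)))))
      where open ≡-Reasoning

    ∙x∈orbit⇒square : ∀ {v} → v ∙ x ∈ orbit v → IsSquare x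
    ∙x∈orbit⇒square {v} (here v∙x≡v) =
      ⊥-elim (x≢e (cancelˡ v x e (trans v∙x≡v (sym (identityʳ v)))))
    ∙x∈orbit⇒square {v} (there (here v∙x≡v⁻¹)) = v , (begin
      v ∙ v        ≡⟨ inverseˡ-unique (v ∙ v) x (begin
                        v ∙ v ∙ x     ≡⟨ assoc v v x ⟩
                        v ∙ (v ∙ x)   ≡⟨ cong (v ∙_) v∙x≡v⁻¹ ⟩
                        v ∙ v ⁻¹      ≡⟨ inverseʳ v ⟩
                        e             ∎) ⟩
      x ⁻¹         ≡⟨ x⁻¹≡x ⟩
      x            ∎)
      where open ≡-Reasoning
    ∙x∈orbit⇒square {v} (there (there (here v∙x≡x∙v∙x))) =
      ⊥-elim (x≢e (sym (cancelʳ v e x (trans (identityˡ v) (cancelʳ x v (x ∙ v) v∙x≡x∙v∙x)))))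
    ∙x∈orbit⇒square {v} (there (there (there (here v∙x≡x∙v⁻¹∙x)))) = v , (begin
      v ∙ v               ≡⟨ cong (_∙ v) (cancelʳ x v (x ∙ v ⁻¹) v∙x≡x∙v⁻¹∙x) ⟩
      x ∙ v ⁻¹ ∙ v        ≡⟨ inverse-cancelʳ (inverseˡ v) x ⟩
      x                   ∎)
      where open ≡-Reasoning

    -- Opaque because unfolding argmin during unification is prohibitively slow.
    opaque
      rep : Fin n → Fin n
      rep v = argmin toℕ v (orbit v)

      rep-∈-orbit : ∀ v → rep v ∈ orbit v
      rep-∈-orbit v = argmin-∈ toℕ (orbit v) (here refl)

      rep-minimal : ∀ {a v} → a ∈ orbit v → toℕ (rep v) ≤ toℕ a
      rep-minimal {v = v} = argmin-minimal toℕ v (orbit v)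

    rep-orbitInvariant : ∀ {a v} → a ∈ orbit v → rep a ≡ rep v
    rep-orbitInvariant {a} {v} a∈ = toℕ-injective (≤-antisym
      (rep-minimal (orbit-⊆ (orbit-sym a∈) (rep-∈-orbit v)))
      (rep-minimal (orbit-⊆ a∈ (rep-∈-orbit a))))

    rep-∙x∙x : ∀ v → rep (v ∙ x ∙ x) ≡ rep v
    rep-∙x∙x v = cong rep (inverse-cancelʳ x∙x≡e v)

    ¬square⇒rep-separates : ¬ IsSquare x → ∀ v → rep v ≢ rep (v ∙ x)
    ¬square⇒rep-separates ¬square v rep≡ = ¬square (∙x∈orbit⇒square
      (orbit-⊆ (subst (_∈ orbit v) rep≡ (rep-∈-orbit v)) (orbit-sym (rep-∈-orbit (v ∙ x)))))

    connectionSet : Pred (Fin n) 0ℓ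
    connectionSet v = ¬ ⟨ x ⟩ v × toℕ (rep v) < toℕ (rep (v ∙ x))

    connectionSet-⁻¹ : ∀ s → connectionSet s → connectionSet (s ⁻¹)
    connectionSet-⁻¹ s (s∉ , rep<) = ∉⟨x⟩-⁻¹ s∉ ,
      subst₂ (λ a b → toℕ a < toℕ b)
        (sym (rep-orbitInvariant (there (here refl))))
        (sym (rep-orbitInvariant (⁻¹∙x∈orbit[∙x] s)))
        rep<

    connectionSet-choice : ¬ IsSquare x → ∀ v → ¬ ⟨ x ⟩ v →
      (connectionSet v × ¬ connectionSet (v ∙ x)) ⊎ (connectionSet (v ∙ x) × ¬ connectionSet v)
    connectionSet-choice ¬square v v∉ with <-cmp (toℕ (rep v)) (toℕ (rep (v ∙ x)))
    ... | tri< rep< _ _ = inj₁ ((v∉ , rep<) ,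
      λ (_ , rep>) → <-asym rep< (subst (λ a → toℕ (rep (v ∙ x)) < toℕ a) (rep-∙x∙x v) rep>))
    ... | tri≈ _ rep≡ _ = ⊥-elim (¬square⇒rep-separates ¬square v (toℕ-injective rep≡))
    ... | tri> _ _ rep> = inj₂
      ((∉⟨x⟩-∙x v∉ , subst (λ a → toℕ (rep (v ∙ x)) < toℕ a) (sym (rep-∙x∙x v)) rep>) ,
       λ (_ , rep<) → <-asym rep< rep>)

    ¬square⇒perfectCode : ¬ IsSquare x → IsPerfectCode ⟨ x ⟩
    ¬square⇒perfectCode ¬square =
      connectionSet ,
      (connectionSet-⁻¹ , (λ (e∉ , _) → e∉ e∈⟨x⟩)) ,
      perfectCodeIn-⟨x⟩ connectionSet (λ _ h∈ (h∉ , _) → h∉ h∈) (connectionSet-choice ¬square)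

lemma3p1 : (n : ℕ) (G : FinGroup n) (x : Fin n) → FinGroup.Involution G x →
    (FinGroup.IsPerfectCode G (FinGroup.⟨_⟩ G x) → ¬ FinGroup.IsSquare G x) ×
    (¬ FinGroup.IsSquare G x → FinGroup.IsPerfectCode G (FinGroup.⟨_⟩ G x))
lemma3p1 n G x x-involution =
  perfectCode⇒¬square G x x-involution , ¬square⇒perfectCode G x x-involution
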